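{- For every set of names $\rho$, active context $C[\cdot]$, name $a$, prefix $\alpha_a$ with subject $a$ and process $Q$: if $\rho\vdash C[\alpha_a.Q]$ and $a\notin\rho$, then $\mathrm{auth}(C[\cdot],a)$ is true.
   Context: Processes: $P,Q ::= 0 \mid P \mid Q \mid (\nu a)P \mid (a)P \mid \alpha.P$, with prefixes $\alpha ::= \overline{a}\langle b\rangle$ (output) $\mid a(x)$ (input, binding $x$) $\mid \overline{a}\{b\}$ (send authorization for $b$ on $a$) $\mid a\{b\}$ (receive authorization for $b$ on $a$). $(a)P$ is the authorization scope and does not bind $a$. We write $\alpha_a$ for any prefix whose subject is $a$, i.e. $\overline{a}\langle b\rangle$, $a(x)$, $\overline{a}\{b\}$ or $a\{b\}$. Active contexts: $C[\cdot] ::= \cdot \mid P\mid C[\cdot] \mid (\nu b)C[\cdot] \mid (b)C[\cdot]$; $C[R]$ is the result of filling the hole with $R$. The predicate $\mathrm{auth}(C[\cdot],a)$ is defined by: false if $C=\cdot$; true if $C=(a)C'$; $\mathrm{auth}(C',a)$ if $C=(b)C'$ with $b\neq a$, or $C=P\mid C'$, or $C=(\nu b)C'$. Typing: $\rho$ is a set of names; $\rho\vdash P$ is the least relation closed under: $\emptyset\vdash 0$; from $\rho_1\vdash P$, $\rho_2\vdash Q$ infer $\rho_1\cup\rho_2\vdash P\mid Q$; from $\rho\vdash P$, $a\notin\rho$ infer $\rho\vdash(\nu a)P$; from $\rho\vdash P$ infer $\rho\setminus\{a\}\vdash(a)P$; from $\rho\vdash P$ infer $\rho\cup\{a\}\vdash\overline{a}\langle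 b\rangle.P$; from $\rho\vdash P$, $x\notin\rho$ infer $\rho\cup\{a\}\vdash a(x).P$; from $\rho\vdash P$, $b\notin\rho$ infer $\rho\cup\{a,b\}\vdash\overline{a}\{b\}.P$; from $\rho\vdash P$ infer $(\rho\setminus\{b\})\cup\{a\}\vdash a\{b\}.P$. -}

module Defs where

open import Data.Nat using (ℕ)
open import Data.Empty using (⊥)
open import Data.Unit using (⊤)
open import Data.Sum using (_⊎_)
open import Data.Product using (_×_)
open import Relation.Binary.PropositionalEquality using (_≡_)
open import Relation.Nullary using (¬_)

Name : Set
Name = ℕ

NameSet : Set₁
NameSet = Name → Set

∅ : NameSet
∅ _ = ⊥

_∪_ : NameSet → NameSet → NameSet
(ρ₁ ∪ ρ₂) x = ρ₁ x ⊎ ρ₂ x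

_∖_ : NameSet → Name → NameSet
(ρ ∖ a) x = ρ x × ¬ (x ≡ a)

⁅_⁆ : Name → NameSet
⁅ a ⁆ x = x ≡ a

_∉_ : Name → NameSet → Set
a ∉ ρ = ¬ (ρ a)

infixr 6 _∪_
infixl 7 _∖_

data Prefix : Set where
  out   : Name → Name → Prefix
  inp   : Name → Name → Prefix   -- a(x), binds x
  aout  : Name → Name → Prefix
  ainp  : Name → Name → Prefix

subj : Prefix → Name
subj (out a _)  = a
subj (inp a _)  = a
subj (aout a _) = a
subj (ainp a _) = a

data Proc : Set where
  𝟎    : Proc
  _∥_  : Proc → Proc → Proc
  ν    : Name → Proc → Proc
  auth : Name → Proc → Proc
  _·_  : Prefix → Proc → Proc

data Ctx : Set where
  hole  : Ctx
  _∥C_  : Proc → Ctx → Ctx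
  νC    : Name → Ctx → Ctx
  authC : Name → Ctx → Ctx

_[_] : Ctx → Proc → Proc
hole [ R ]        = R
(P ∥C C) [ R ]    = P ∥ (C [ R ])
νC b C [ R ]      = ν b (C [ R ])
authC b C [ R ]   = auth b (C [ R ])

open import Relation.Nullary using (yes; no)
open import Data.Nat using (_≟_)
open import Data.Bool using (Bool; true; false)

authCtx : Ctx → Name → Bool
authCtx hole a = false
authCtx (authC b C) a with b ≟ a
... | yes _ = true
... | no  _ = authCtx C a
authCtx (P ∥C C) a = authCtx C a
authCtx (νC b C) a = authCtx C a

data _⊢_ : NameSet → Proc → Set₁ where
  t-nil  : ∅ ⊢ 𝟎
  t-par  : ∀ {ρ₁ ρ₂ P Q} → ρ₁ ⊢ P → ρ₂ ⊢ Q → (ρ₁ ∪ ρ₂) ⊢ (P ∥ Q)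
  t-res  : ∀ {ρ P a} → ρ ⊢ P → a ∉ ρ → ρ ⊢ ν a P
  t-auth : ∀ {ρ P a} → ρ ⊢ P → (ρ ∖ a) ⊢ auth a P
  t-out  : ∀ {ρ P a b} → ρ ⊢ P → (ρ ∪ ⁅ a ⁆) ⊢ (out a b · P)
  t-inp  : ∀ {ρ P a x} → ρ ⊢ P → x ∉ ρ → (ρ ∪ ⁅ a ⁆) ⊢ (inp a x · P)
  t-aout : ∀ {ρ P a b} → ρ ⊢ P → b ∉ ρ → (ρ ∪ ⁅ a ⁆ ∪ ⁅ b ⁆) ⊢ (aout a b · P)
  t-ainp : ∀ {ρ P a b} → ρ ⊢ P → ((ρ ∖ b) ∪ ⁅ a ⁆) ⊢ (ainp a b · P)

infix 4 _⊢_

module Submission where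

-- A process guarded by a prefix with subject a is typed only by sets
-- containing a: every prefix rule adds its subject.  Going outwards through
-- an active context, the type of the filled process can lose a name only at
-- an authorization scope (a): parallel composition takes unions and
-- restriction keeps the set unchanged.  Hence, if the context does not
-- authorize a, the name a must survive to the type ρ of the whole process.

open import Defs
open import Data.Bool using (true; false)
open import Data.Empty using (⊥-elim)
open import Data.Nat using (_≟_)
open import Data.Product using (_,_)
open import Data.Sum using (inj₁; inj₂)
open import Relation.Binary.PropositionalEquality using (_≡_; refl)
open import Relation.Nullary using (yes; no)

subject-used : ∀ {ρ α Q} → ρ ⊢ α · Q → ρ (subj α)
subject-used {α = out _ _}  (t-out _)    = inj₂ refl
subject-used {α = inp _ _}  (t-inp _ _)  = inj₂ refl
subject-used {α = aout _ _} (t-aout _ _) = inj₂ (inj₁ refl)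
subject-used {α = ainp _ _} (t-ainp _)   = inj₂ refl

unauthorized-name-escapes : ∀ {ρ} (C : Ctx) (a : Name) {R : Proc}
  → (∀ {σ} → σ ⊢ R → σ a)
  → authCtx C a ≡ false
  → ρ ⊢ C [ R ] → ρ a
unauthorized-name-escapes hole        a used-in-R _ d = used-in-R d
unauthorized-name-escapes (P ∥C C)    a used-in-R noAuth (t-par _ d) =
  inj₂ (unauthorized-name-escapes C a used-in-R noAuth d)
unauthorized-name-escapes (νC b C)    a used-in-R noAuth (t-res d _) =
  unauthorized-name-escapes C a used-in-R noAuth d
unauthorized-name-escapes (authC b C) a used-in-R noAuth (t-auth d) with b ≟ a
... | yes _ with () ← noAuth
... | no b≢a = unauthorized-name-escapes C a used-in-R noAuth d
             , λ { refl → b≢a refl }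

proposition3 : (ρ : NameSet) (C : Ctx) (a : Name) (α : Prefix) (Q : Proc)
    → subj α ≡ a
    → ρ ⊢ C [ α · Q ]
    → a ∉ ρ
    → authCtx C a ≡ true
proposition3 ρ C a α Q refl d a∉ρ with authCtx C a in eq
... | true  = refl
... | false = ⊥-elim (a∉ρ (unauthorized-name-escapes C a subject-used eq d))
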